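{- If $M\to_{\mathtt{dBang}} N$ at the root, then for any resource approximant $m$ of $M$ (written $m\triangleleft M$), either $m$ reduces to the empty sum $\emptyset$ in the resource calculus, or there is some $n\triangleleft N$ such that $m$ reduces to $n$ in the resource calculus.
   Context: dBang terms: $M ::= x \mid \lambda x M \mid MN \mid {!}M \mid \mathrm{der}(M) \mid M[N/x]$; list contexts $L ::= \square\mid L[N/x]$; root rules $L\langle\lambda xM\rangle P\mapsto L\langle M[P/x]\rangle$, $N[L\langle{!}P\rangle/x]\mapsto L\langle N\{P/x\}\rangle$, $\mathrm{der}(L\langle{!}N\rangle)\mapsto L\langle N\rangle$. Resource terms replace ${!}N$ by finite multisets (bags) $[n_1,\dots,n_k]$ with $n_i\triangleleft N$; approximation $\triangleleft$ is otherwise structural. Resource reduction is linear: e.g. $\mathrm{der}(l\langle[n_1,\dots,n_k]\rangle)$ reduces to $l\langle n_1\rangle$ if $k=1$ and to $\emptyset$ otherwise; $n[l\langle[p_1,\dots,p_k]\rangle/x]$ reduces to $\emptyset$ if the number of occurrences of $x$ in $n$ differs from $k$, and otherwise to the sum over permutations distributing the $p_i$ to the occurrences of $x$. -}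

module Defs where

open import Data.Nat using (ℕ; zero; suc; _+_; pred; _<ᵇ_; _≡ᵇ_)
open import Data.Bool using (if_then_else_)
open import Data.List using (List; []; _∷_; length; map; concatMap)
open import Data.List.Relation.Unary.All using (All)
open import Data.Product using (_×_; _,_; proj₁)
open import Relation.Binary.PropositionalEquality using (_≡_)
open import Relation.Nullary using (¬_)

-- dBang terms, de Bruijn indices.
--   var i, lam M, app M N, bang M (= !M), der M, esub M N (= M[N/x],
--   where x is index 0 of M, i.e. esub binds index 0 in its first arg).

data Term : Set where
  var  : ℕ → Term
  lam  : Term → Term
  app  : Term → Term → Term
  bang : Term → Term
  der  : Term → Term
  esub : Term → Term → Term

shift : ℕ → ℕ → Term → Term
shift c d (var i) = if i <ᵇ c then var i else var (i + d)
shift c d (lam M) = lam (shift (suc c) d M)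
shift c d (app M N) = app (shift c d M) (shift c d N)
shift c d (bang M) = bang (shift c d M)
shift c d (der M) = der (shift c d M)
shift c d (esub M N) = esub (shift (suc c) d M) (shift c d N)

sub : ℕ → Term → Term → Term
sub j P (var i) = if i <ᵇ j then var i else (if i ≡ᵇ j then shift 0 j P else var (pred i))
sub j P (lam M) = lam (sub (suc j) P M)
sub j P (app M N) = app (sub j P M) (sub j P N)
sub j P (bang M) = bang (sub j P M)
sub j P (der M) = der (sub j P M)
sub j P (esub M N) = esub (sub (suc j) P M) (sub j P N)

-- list contexts L ::= □ | L[N/x]; the list [N₁, …, N_k] denotes
-- □[N_k/x_k]…[N₁/x₁] (head = outermost explicit substitution).
plug : List Term → Term → Term
plug [] M = M
plug (N ∷ L) M = esub (plug L M) N

data _↦_ : Term → Term → Set where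
  dB   : ∀ L M P → app (plug L (lam M)) P ↦ plug L (esub M (shift 0 (length L) P))
  sbang : ∀ N L P → esub N (plug L (bang P)) ↦ plug L (sub 0 P (shift 1 (length L) N))
  dder : ∀ L N → der (plug L (bang N)) ↦ plug L N

-- Resource terms: !N replaced by finite bags (lists read as multisets).

data RTerm : Set where
  rvar  : ℕ → RTerm
  rlam  : RTerm → RTerm
  rapp  : RTerm → RTerm → RTerm
  rbag  : List RTerm → RTerm
  rder  : RTerm → RTerm
  resub : RTerm → RTerm → RTerm

-- finite formal sums of resource terms (multisets, as lists); [] is ∅
RSum : Set
RSum = List RTerm

mutual
  rshift : ℕ → ℕ → RTerm → RTerm
  rshift c d (rvar i) = if i <ᵇ c then rvar i else rvar (i + d)
  rshift c d (rlam m) = rlam (rshift (suc c) d m)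
  rshift c d (rapp m n) = rapp (rshift c d m) (rshift c d n)
  rshift c d (rbag ps) = rbag (rshiftBag c d ps)
  rshift c d (rder m) = rder (rshift c d m)
  rshift c d (resub m n) = resub (rshift (suc c) d m) (rshift c d n)

  rshiftBag : ℕ → ℕ → List RTerm → List RTerm
  rshiftBag c d [] = []
  rshiftBag c d (p ∷ ps) = rshift c d p ∷ rshiftBag c d ps

mutual
  occ : ℕ → RTerm → ℕ
  occ j (rvar i) = if i ≡ᵇ j then 1 else 0
  occ j (rlam m) = occ (suc j) m
  occ j (rapp m n) = occ j m + occ j n
  occ j (rbag ps) = occBag j ps
  occ j (rder m) = occ j m
  occ j (resub m n) = occ (suc j) m + occ j n

  occBag : ℕ → List RTerm → ℕ
  occBag j [] = 0
  occBag j (p ∷ ps) = occ j p + occBag j ps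

-- linear substitution: the occurrences of index j are replaced, from left
-- to right, by the successive elements of the given list (each used once);
-- indices above j are decremented.  Returns the unused elements.
useHead : ℕ → ℕ → List RTerm → RTerm × List RTerm
useHead j i [] = rvar i , []
useHead j i (q ∷ qs) = rshift 0 j q , qs

mutual
  lsub : ℕ → RTerm → List RTerm → RTerm × List RTerm
  lsub j (rvar i) qs =
    if i <ᵇ j then (rvar i , qs)
    else (if i ≡ᵇ j then useHead j i qs else (rvar (pred i) , qs))
  lsub j (rlam m) qs with lsub (suc j) m qs
  ... | m' , qs' = rlam m' , qs'
  lsub j (rapp m n) qs with lsub j m qs
  ... | m' , qs' with lsub j n qs'
  ... | n' , qs'' = rapp m' n' , qs''
  lsub j (rbag ps) qs with lsubBag j ps qs
  ... | ps' , qs' = rbag ps' , qs'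
  lsub j (rder m) qs with lsub j m qs
  ... | m' , qs' = rder m' , qs'
  lsub j (resub m n) qs with lsub (suc j) m qs
  ... | m' , qs' with lsub j n qs'
  ... | n' , qs'' = resub m' n' , qs''

  lsubBag : ℕ → List RTerm → List RTerm → List RTerm × List RTerm
  lsubBag j [] qs = [] , qs
  lsubBag j (p ∷ ps) qs with lsub j p qs
  ... | p' , qs' with lsubBag j ps qs'
  ... | ps' , qs'' = p' ∷ ps' , qs''

insertions : {A : Set} → A → List A → List (List A)
insertions x [] = (x ∷ []) ∷ []
insertions x (y ∷ ys) = (x ∷ y ∷ ys) ∷ map (y ∷_) (insertions x ys)

perms : {A : Set} → List A → List (List A)
perms [] = [] ∷ []
perms (x ∷ xs) = concatMap (insertions x) (perms xs)

rplug : List RTerm → RTerm → RTerm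
rplug [] m = m
rplug (n ∷ l) m = resub (rplug l m) n

data _↦r_ : RTerm → RSum → Set where
  rB    : ∀ l m p →
          rapp (rplug l (rlam m)) p ↦r (rplug l (resub m (rshift 0 (length l) p)) ∷ [])
  rder1 : ∀ l n → rder (rplug l (rbag (n ∷ []))) ↦r (rplug l n ∷ [])
  rder0 : ∀ l → rder (rplug l (rbag [])) ↦r []
  rder2 : ∀ l p q ps → rder (rplug l (rbag (p ∷ q ∷ ps))) ↦r []
  rsubOk : ∀ n l ps → occ 0 n ≡ length ps →
           resub n (rplug l (rbag ps))
             ↦r map (λ qs → rplug l (proj₁ (lsub 0 (rshift 1 (length l) n) qs))) (perms ps)
  rsubNo : ∀ n l ps → ¬ (occ 0 n ≡ length ps) → resub n (rplug l (rbag ps)) ↦r []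

data _◁_ : RTerm → Term → Set where
  avar  : ∀ i → rvar i ◁ var i
  alam  : ∀ {m M} → m ◁ M → rlam m ◁ lam M
  aapp  : ∀ {m n M N} → m ◁ M → n ◁ N → rapp m n ◁ app M N
  abag  : ∀ {ps N} → All (_◁ N) ps → rbag ps ◁ bang N
  ader  : ∀ {m M} → m ◁ M → rder m ◁ der M
  aesub : ∀ {m n M N} → m ◁ M → n ◁ N → resub m n ◁ esub M N

-- Approximation is structural, and it commutes with shifting and with list contexts,
-- so a root step of M is mirrored by the corresponding linear step of m ◁ M. That
-- step either produces ∅ (a bag of the wrong size) or approximants of the reduct.
-- The only real work is the substitution case: filling the occurrences of x in an
-- approximant of N with approximants of P, in any order, approximates N{P/x}.
module Submission where

open import Defs
open import Data.Bool using (true; false)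
open import Data.Empty using (⊥-elim)
open import Data.List using (List; []; _∷_; length; map)
open import Data.List.Properties using (++-conicalˡ)
open import Data.List.Relation.Binary.Permutation.Propositional
  using (_↭_; ↭-refl; ↭-sym; ↭-prep; ↭-swap; ↭-trans)
open import Data.List.Relation.Binary.Permutation.Propositional.Properties
  using (All-resp-↭; ↭-length)
open import Data.List.Relation.Binary.Pointwise using (Pointwise; []; _∷_; Pointwise-length)
open import Data.List.Relation.Unary.All using (All; []; _∷_)
import Data.List.Relation.Unary.All as All
open import Data.List.Relation.Unary.All.Properties using (map⁺; concat⁺)
open import Data.Nat using (ℕ; zero; suc; _+_; _≤_; _<_; _<ᵇ_; _≡ᵇ_; s<s; z<s)
open import Data.Nat.Properties
  using (<ᵇ⇒<; ≡ᵇ⇒≡; <ᵇ-reflects-<; ≮⇒≥; <-irrefl; <-≤-trans; ≤-trans; m≤m+n; +-assoc;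
         +-cancelˡ-≤; ≤-reflexive; _≟_)
open import Data.Product using (∃; _×_; _,_; proj₁; proj₂)
open import Data.Sum using (_⊎_; inj₁; inj₂)
open import Relation.Nullary using (yes; no)
open import Relation.Nullary.Reflects using (ofⁿ)
open import Relation.Binary.PropositionalEquality
  using (_≡_; _≢_; refl; sym; trans; cong; cong₂; subst)
open Relation.Binary.PropositionalEquality.≡-Reasoning

>⇒≡ᵇ-false : ∀ {i j} → j < i → (i ≡ᵇ j) ≡ false
>⇒≡ᵇ-false {suc i} {zero} _ = refl
>⇒≡ᵇ-false {suc i} {suc j} (s<s j<i) = >⇒≡ᵇ-false j<i

mutual
  rshift-◁ : ∀ c d {m M} → m ◁ M → rshift c d m ◁ shift c d M
  rshift-◁ c d (avar i) with i <ᵇ c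
  ... | true  = avar i
  ... | false = avar (i + d)
  rshift-◁ c d (alam a)    = alam (rshift-◁ (suc c) d a)
  rshift-◁ c d (aapp a b)  = aapp (rshift-◁ c d a) (rshift-◁ c d b)
  rshift-◁ c d (abag as)   = abag (rshiftBag-◁ c d as)
  rshift-◁ c d (ader a)    = ader (rshift-◁ c d a)
  rshift-◁ c d (aesub a b) = aesub (rshift-◁ (suc c) d a) (rshift-◁ c d b)

  rshiftBag-◁ : ∀ c d {ps N} → All (_◁ N) ps → All (_◁ shift c d N) (rshiftBag c d ps)
  rshiftBag-◁ c d []       = []
  rshiftBag-◁ c d (a ∷ as) = rshift-◁ c d a ∷ rshiftBag-◁ c d as

mutual
  occ-rshift : ∀ {c j} d → j < c → ∀ n → occ j (rshift c d n) ≡ occ j n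
  occ-rshift {c} {j} d j<c (rvar i) with i <ᵇ c | <ᵇ-reflects-< i c
  ... | true  | _ = refl
  ... | false | ofⁿ i≮c
    rewrite >⇒≡ᵇ-false (<-≤-trans j<c (≤-trans (≮⇒≥ i≮c) (m≤m+n i d)))
          | >⇒≡ᵇ-false (<-≤-trans j<c (≮⇒≥ i≮c)) = refl
  occ-rshift d j<c (rlam n) = occ-rshift d (s<s j<c) n
  occ-rshift d j<c (rapp m n) = cong₂ _+_ (occ-rshift d j<c m) (occ-rshift d j<c n)
  occ-rshift d j<c (rbag ps) = occBag-rshiftBag d j<c ps
  occ-rshift d j<c (rder n) = occ-rshift d j<c n
  occ-rshift d j<c (resub m n) = cong₂ _+_ (occ-rshift d (s<s j<c) m) (occ-rshift d j<c n)

  occBag-rshiftBag : ∀ {c j} d → j < c → ∀ ps → occBag j (rshiftBag c d ps) ≡ occBag j ps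
  occBag-rshiftBag d j<c []       = refl
  occBag-rshiftBag d j<c (p ∷ ps) = cong₂ _+_ (occ-rshift d j<c p) (occBag-rshiftBag d j<c ps)

record Remains (P : Term) (k : ℕ) (qs qs' : List RTerm) : Set where
  constructor remains
  field
    leftover-◁ : All (_◁ P) qs'
    length-leftover : k + length qs' ≡ length qs

open Remains

remains-≤ : ∀ {P a b qs qs'} → Remains P a qs qs' → a + b ≤ length qs → b ≤ length qs'
remains-≤ {a = a} {b} (remains _ eq) le = +-cancelˡ-≤ a b _ (subst (a + b ≤_) (sym eq) le)

remains-trans : ∀ {P a b qs qs' qs''} →
  Remains P a qs qs' → Remains P b qs' qs'' → Remains P (a + b) qs qs''
remains-trans {a = a} {b} {qs} {qs'} {qs''} (remains _ eq₁) (remains aq'' eq₂) =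
  remains aq'' (begin
    a + b + length qs''   ≡⟨ +-assoc a b (length qs'') ⟩
    a + (b + length qs'') ≡⟨ cong (a +_) eq₂ ⟩
    a + length qs'        ≡⟨ eq₁ ⟩
    length qs             ∎)

-- Without enough resources lsub leaves an occurrence of j as a bare variable, which
-- approximates nothing useful; hence the bound on occ j n.
mutual
  lsub-◁ : ∀ j {P n N} → n ◁ N → ∀ qs → All (_◁ P) qs → occ j n ≤ length qs →
    proj₁ (lsub j n qs) ◁ sub j P N × Remains P (occ j n) qs (proj₂ (lsub j n qs))
  lsub-◁ j (avar i) qs aq le with i <ᵇ j | <ᵇ⇒< i j | i ≡ᵇ j | ≡ᵇ⇒≡ i j
  ... | true  | i<j | true  | i≡j = ⊥-elim (<-irrefl (i≡j _) (i<j _))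
  ... | true  | _   | false | _   = avar i , remains aq refl
  ... | false | _   | false | _   = avar _ , remains aq refl
  lsub-◁ j (avar i) []       _        () | false | _ | true | _
  lsub-◁ j (avar i) (q ∷ qs) (a ∷ aq) le | false | _ | true | _ = rshift-◁ 0 j a , remains aq refl
  lsub-◁ j (alam {m} a) qs aq le with lsub (suc j) m qs | lsub-◁ (suc j) a qs aq le
  ... | _ , _ | am , r = alam am , r
  lsub-◁ j (aapp {m} {n} a b) qs aq le
    with lsub j m qs | lsub-◁ j a qs aq (≤-trans (m≤m+n _ _) le)
  ... | _ , qs' | am , r₁
    with lsub j n qs' | lsub-◁ j b qs' (leftover-◁ r₁) (remains-≤ r₁ le)
  ... | _ , _ | an , r₂ = aapp am an , remains-trans r₁ r₂
  lsub-◁ j (abag {ps} as) qs aq le with lsubBag j ps qs | lsubBag-◁ j as qs aq le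
  ... | _ , _ | aps , r = abag aps , r
  lsub-◁ j (ader {m} a) qs aq le with lsub j m qs | lsub-◁ j a qs aq le
  ... | _ , _ | am , r = ader am , r
  lsub-◁ j (aesub {m} {n} a b) qs aq le
    with lsub (suc j) m qs | lsub-◁ (suc j) a qs aq (≤-trans (m≤m+n _ _) le)
  ... | _ , qs' | am , r₁
    with lsub j n qs' | lsub-◁ j b qs' (leftover-◁ r₁) (remains-≤ r₁ le)
  ... | _ , _ | an , r₂ = aesub am an , remains-trans r₁ r₂

  lsubBag-◁ : ∀ j {P ps N} → All (_◁ N) ps → ∀ qs → All (_◁ P) qs → occBag j ps ≤ length qs →
    All (_◁ sub j P N) (proj₁ (lsubBag j ps qs)) × Remains P (occBag j ps) qs (proj₂ (lsubBag j ps qs))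
  lsubBag-◁ j [] qs aq le = [] , remains aq refl
  lsubBag-◁ j (_∷_ {p} {ps} a as) qs aq le
    with lsub j p qs | lsub-◁ j a qs aq (≤-trans (m≤m+n _ _) le)
  ... | _ , qs' | ap , r₁
    with lsubBag j ps qs' | lsubBag-◁ j as qs' (leftover-◁ r₁) (remains-≤ r₁ le)
  ... | _ , _ | aps , r₂ = ap ∷ aps , remains-trans r₁ r₂

insertions-↭ : ∀ {A : Set} (x : A) ys → All (_↭ x ∷ ys) (insertions x ys)
insertions-↭ x []       = ↭-refl ∷ []
insertions-↭ x (y ∷ ys) =
  ↭-refl ∷ map⁺ (All.map (λ p → ↭-trans (↭-prep y p) (↭-swap y x ↭-refl)) (insertions-↭ x ys))

perms-↭ : ∀ {A : Set} (xs : List A) → All (_↭ xs) (perms xs)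
perms-↭ []       = ↭-refl ∷ []
perms-↭ (x ∷ xs) =
  concat⁺ (map⁺ (All.map (λ {ys} p → All.map (λ q → ↭-trans q (↭-prep x p)) (insertions-↭ x ys))
                         (perms-↭ xs)))

insertions≢[] : ∀ {A : Set} (x : A) ys → insertions x ys ≢ []
insertions≢[] x []      ()
insertions≢[] x (_ ∷ _) ()

perms≢[] : ∀ {A : Set} (xs : List A) → perms xs ≢ []
perms≢[] []       ()
perms≢[] (x ∷ xs) with perms xs | perms≢[] xs
... | []     | ne = λ _ → ne refl
... | ys ∷ _ | _  = λ eq → insertions≢[] x ys (++-conicalˡ (insertions x ys) _ eq)

map≢[] : ∀ {A B : Set} (f : A → B) {xs} → xs ≢ [] → map f xs ≢ []
map≢[] f {[]}    ne _ = ne refl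
map≢[] f {_ ∷ _} _  ()

plug-◁ : ∀ {l L m M} → Pointwise _◁_ l L → m ◁ M → rplug l m ◁ plug L M
plug-◁ []       a = a
plug-◁ (b ∷ pw) a = aesub (plug-◁ pw a) b

data PlugApprox (L : List Term) (M : Term) : RTerm → Set where
  plugged : ∀ {l m} → Pointwise _◁_ l L → m ◁ M → PlugApprox L M (rplug l m)

◁-plug⁻¹ : ∀ L {M m} → m ◁ plug L M → PlugApprox L M m
◁-plug⁻¹ []      a = plugged [] a
◁-plug⁻¹ (_ ∷ L) (aesub a b) with ◁-plug⁻¹ L a
... | plugged pw a' = plugged (b ∷ pw) a'

rshift-◁-length : ∀ c {l L n N} → Pointwise _◁_ l L → n ◁ N →
  rshift c (length l) n ◁ shift c (length L) N
rshift-◁-length c pw a rewrite Pointwise-length pw = rshift-◁ c _ a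

ReducesToApprox : RTerm → Term → Set
ReducesToApprox m N = (m ↦r []) ⊎ (∃ λ (ns : RSum) → ns ≢ [] × m ↦r ns × All (_◁ N) ns)

reducesTo-single : ∀ {m n N} → m ↦r (n ∷ []) → n ◁ N → ReducesToApprox m N
reducesTo-single r a = inj₂ (_ , (λ ()) , r , a ∷ [])

dB-simulation : ∀ L {M P m} → m ◁ app (plug L (lam M)) P →
  ReducesToApprox m (plug L (esub M (shift 0 (length L) P)))
dB-simulation L (aapp a ap) with ◁-plug⁻¹ L a
... | plugged {l} pw (alam {m'} am) =
  reducesTo-single (rB l m' _) (plug-◁ pw (aesub am (rshift-◁-length 0 pw ap)))

der-simulation : ∀ L {N m} → m ◁ der (plug L (bang N)) → ReducesToApprox m (plug L N)
der-simulation L (ader a) with ◁-plug⁻¹ L a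
... | plugged {l} pw (abag [])           = inj₁ (rder0 l)
... | plugged {l} pw (abag (ap ∷ []))    = reducesTo-single (rder1 l _) (plug-◁ pw ap)
... | plugged {l} pw (abag (_ ∷ _ ∷ _)) = inj₁ (rder2 l _ _ _)

subst-simulation : ∀ N L {P m} → m ◁ esub N (plug L (bang P)) →
  ReducesToApprox m (plug L (sub 0 P (shift 1 (length L) N)))
subst-simulation N L {P} (aesub {m = n} an a) with ◁-plug⁻¹ L a
... | plugged {l} pw (abag {ps} aps) with occ 0 n ≟ length ps
...   | no occ≢ = inj₁ (rsubNo n l ps occ≢)
...   | yes occ≡ =
  inj₂ (_ , map≢[] _ (perms≢[] ps) , rsubOk n l ps occ≡ , map⁺ (All.map reduct-◁ (perms-↭ ps)))
  where
  reduct-◁ : ∀ {qs} → qs ↭ ps →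
    rplug l (proj₁ (lsub 0 (rshift 1 (length l) n) qs)) ◁ plug L (sub 0 P (shift 1 (length L) N))
  reduct-◁ {qs} qs↭ps =
    plug-◁ pw (proj₁ (lsub-◁ 0 (rshift-◁-length 1 pw an) qs (All-resp-↭ (↭-sym qs↭ps) aps) enough))
    where
    enough : occ 0 (rshift 1 (length l) n) ≤ length qs
    enough = ≤-reflexive (trans (occ-rshift _ z<s n) (trans occ≡ (sym (↭-length qs↭ps))))

mainTheorem2 : ∀ {M N : Term} → M ↦ N → ∀ {m : RTerm} → m ◁ M →
    (m ↦r []) ⊎ (∃ λ (ns : RSum) → ns ≢ [] × m ↦r ns × All (_◁ N) ns)
mainTheorem2 (dB L M P)      = dB-simulation L
mainTheorem2 (sbang N L P)   = subst-simulation N L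
mainTheorem2 (dder L N)      = der-simulation L
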